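{- Let $D=(V,A)$ be a directed acyclic graph with single source $s$ and unit-capacity arcs, in which every node is reachable from $s$, and let $k=2$. Let $\tau=(T_1,T_2)$ be a proper demand. A function $f:A\to\{1,2\}$ is a height function that is feasible for $\tau$ if and only if all of the following hold: (1) for every arc $uv\in A$ with $u\ne s$ and $f(uv)=2$, there is an arc $wu\in A$ with $f(wu)=2$; (2) for every arc $uv\in A$ with $u\ne s$ and $f(uv)=1$, either there is an arc $wu\in A$ with $f(wu)=1$, or $\lambda(s,u)\ge2$; (3) for every receiver $t\in T_1$ with $\lambda(s,t)=1$, some arc entering $t$ has $f$-value $1$; (4) for every $t\in T_2$, some arc entering $t$ has $f$-value $2$.
   Context: $\lambda(s,v)$ denotes the maximum number of arc-disjoint directed paths from $s$ to $v$. A demand is a pair $\tau=(T_1,T_2)$ of disjoint subsets of $V\setminus\{s\}$; nodes in $T_i$ request the first $i$ layers; $d_\tau(v)=i$ for $v\in T_i$ and $0$ otherwise. The demand is proper if $\lambda(s,t)\ge i$ for all $i$ and all $t\in T_i$. A linear network code over $\mathbb{F}_q$ is a map $\mathbf{c}:A\to\mathbb{F}_q^2$ such that for each arc $uv$ with $u\ne s$, $\mathbf{c}(uv)$ lies in the span of $\{\mathbf{c}(wu):wu\in A\}$. The height $h_{\mathbf{c}}(a)$ is the largest index $i$ with nonzero $i$-th coordinate of $\mathbf{c}(a)$ ($0$ for the zero vector). A node $v\ne s$ decodes layer $i$ if $\mathbf{e}_i$ is in the span of the codes on arcs entering $v$; the performance $p_{\mathbf{c}}(v)$ is the largest $i\in\{0,1,2\}$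 such that $v$ decodes all layers $j\le i$. A function $f$ is a height function feasible for $\tau$ if there exist a finite field $\mathbb{F}_q$ and a linear network code $\mathbf{c}$ over it with $h_{\mathbf{c}}=f$ and $p_{\mathbf{c}}(v)\ge d_\tau(v)$ for all $v\ne s$. -}

module Defs where

open import Level using (0ℓ)
open import Data.Nat using (ℕ; zero; suc; _≤_)
open import Data.Fin using (Fin; _≟_)
open import Data.Fin.Subset using (Subset; _∈_; _∉_)
open import Data.List using (List; []; _∷_; filter; allFin)
import Data.List.Membership.Propositional as L
open import Data.List.Relation.Unary.Any using (Any)
open import Data.Product using (_×_; _,_; ∃; Σ)
open import Data.Sum using (_⊎_)
open import Data.Empty using (⊥)
open import Relation.Nullary using (¬_)
open import Relation.Binary.PropositionalEquality using (_≡_; _≢_)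
open import Algebra.Bundles using (CommutativeRing)

record Field : Set₁ where
  field
    commutativeRing : CommutativeRing 0ℓ 0ℓ
  open CommutativeRing commutativeRing public
  field
    0≉1     : ¬ (0# ≈ 1#)
    inverse : ∀ x → ¬ (x ≈ 0#) → ∃ λ y → x * y ≈ 1#

IsFinite : Field → Set
IsFinite F = ∃ λ (xs : List Carrier) → ∀ x → Any (x ≈_) xs
  where open Field F

record Digraph : Set where
  field
    n    : ℕ
    m    : ℕ
    tail : Fin m → Fin n
    head : Fin m → Fin n

module _ (G : Digraph) where
  open Digraph G

  Node : Set
  Node = Fin n

  Arc : Set
  Arc = Fin m

  data Walk : Node → Node → Set where
    []  : ∀ {v} → Walk v v
    _∷_ : ∀ {v} (a : Arc) → Walk (head a) v → Walk (tail a) v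

  arcsOf : ∀ {u v} → Walk u v → List Arc
  arcsOf []      = []
  arcsOf (a ∷ w) = a ∷ arcsOf w

  Acyclic : Set
  Acyclic = ∀ v (w : Walk v v) → arcsOf w ≡ []

  SingleSource : Node → Set
  SingleSource s = (∀ a → head a ≢ s) × (∀ v → v ≢ s → ∃ λ a → head a ≡ v)

  AllReachableFrom : Node → Set
  AllReachableFrom s = ∀ v → Walk s v

  -- there are k pairwise arc-disjoint directed s-v paths
  -- (in a DAG every walk is a path)
  DisjointPaths : Node → Node → ℕ → Set
  DisjointPaths s v k =
    Σ (Fin k → Walk s v) λ P →
      ∀ i j → i ≢ j → ∀ a → a L.∈ arcsOf (P i) → a L.∈ arcsOf (P j) → ⊥

  λ≥ : Node → Node → ℕ → Set
  λ≥ s v k = DisjointPaths s v k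

  λ≡ : Node → Node → ℕ → Set
  λ≡ s v k = DisjointPaths s v k × ¬ DisjointPaths s v (suc k)

  inArcs : Node → List Arc
  inArcs v = filter (λ a → head a ≟ v) (allFin m)

  record Demand (s : Node) : Set where
    field
      T₁ : Subset n
      T₂ : Subset n
      s∉T₁ : s ∉ T₁
      s∉T₂ : s ∉ T₂
      disjoint : ∀ v → v ∈ T₁ → v ∈ T₂ → ⊥

  data DemandIs {s : Node} (τ : Demand s) (v : Node) : ℕ → Set where
    in₁  : v ∈ Demand.T₁ τ → DemandIs τ v 1
    in₂  : v ∈ Demand.T₂ τ → DemandIs τ v 2
    none : v ∉ Demand.T₁ τ → v ∉ Demand.T₂ τ → DemandIs τ v 0

  Proper : ∀ {s} → Demand s → Set
  Proper {s} τ = (∀ t → t ∈ Demand.T₁ τ → λ≥ s t 1)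
               × (∀ t → t ∈ Demand.T₂ τ → λ≥ s t 2)

  module _ (F : Field) where
    open Field F

    Vec2 : Set
    Vec2 = Carrier × Carrier

    _≈²_ : Vec2 → Vec2 → Set
    (x₁ , x₂) ≈² (y₁ , y₂) = (x₁ ≈ y₁) × (x₂ ≈ y₂)

    _·_ : Carrier → Vec2 → Vec2
    β · (x₁ , x₂) = (β * x₁ , β * x₂)

    _⊕_ : Vec2 → Vec2 → Vec2
    (x₁ , x₂) ⊕ (y₁ , y₂) = (x₁ + y₁ , x₂ + y₂)

    zero² : Vec2
    zero² = (0# , 0#)

    lincomb : (Arc → Carrier) → (Arc → Vec2) → List Arc → Vec2
    lincomb β c []       = zero²
    lincomb β c (a ∷ as) = (β a · c a) ⊕ lincomb β c as

    InSpanIn : (Arc → Vec2) → Node → Vec2 → Set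
    InSpanIn c u x = ∃ λ (β : Arc → Carrier) → x ≈² lincomb β c (inArcs u)

    IsLinearNetworkCode : Node → (Arc → Vec2) → Set
    IsLinearNetworkCode s c = ∀ a → tail a ≢ s → InSpanIn c (tail a) (c a)

    data HeightIs (x : Vec2) : ℕ → Set where
      h2 : ¬ (Data.Product.proj₂ x ≈ 0#) → HeightIs x 2
      h1 : Data.Product.proj₂ x ≈ 0# → ¬ (Data.Product.proj₁ x ≈ 0#) → HeightIs x 1
      h0 : Data.Product.proj₂ x ≈ 0# → Data.Product.proj₁ x ≈ 0# → HeightIs x 0

    unit : ℕ → Vec2
    unit 1 = (1# , 0#)
    unit 2 = (0# , 1#)
    unit _ = zero²

    Decodes : (Arc → Vec2) → Node → ℕ → Set
    Decodes c v i = InSpanIn c v (unit i)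

    PerformanceAtLeast : (Arc → Vec2) → Node → ℕ → Set
    PerformanceAtLeast c v i = ∀ j → 1 ≤ j → j ≤ i → Decodes c v j

  FeasibleHeightFunction : ∀ {s} → Demand s → (Arc → ℕ) → Set₁
  FeasibleHeightFunction {s} τ f =
    ∃ λ (F : Field) → IsFinite F ×
      ∃ λ (c : Arc → Vec2 F) →
        IsLinearNetworkCode F s c
        × (∀ a → HeightIs F (c a) (f a))
        × (∀ v → v ≢ s → ∀ d → DemandIs τ v d → PerformanceAtLeast F c v d)

-- Necessity. A linear code cannot create height: the codes entering a node u span a vector of
-- height 2 only if some arc entering u has height 2, which gives (1) and (4). If instead u
-- receives a vector of height 1 while all its entering arcs have height 2, two entering arcs
-- carry independent codes. Independent codes on arcs a and b are carried by arc-disjoint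
-- routes from s: the nonzero determinant det(c a, c b) passes to an arc entering the tail of a
-- (or of b), so both routes can be traced back to s, and they cannot meet without closing a
-- cycle. This gives (2) and (3). Equality in the field need not be decidable, so the tracing
-- only yields ¬ ¬ λ(s,u) ≥ 2; deciding λ(s,u) ≥ 2 by enumerating walks removes the negations.
--
-- Sufficiency. Work over ℤ/pℤ for a prime p larger than the number of arcs. An arc of height 1
-- gets the code e₁, and an arc a of height 2 gets (origin a , 1) for an arc origin a: a itself
-- if the tail of a is s or already receives all of (ℤ/pℤ)², and otherwise the common origin of
-- the height-2 arcs entering the tail of a. Every route from s ending with a passes through
-- origin a. So if a node v ≠ s does not receive everything and has no entering arc of height 1,
-- all paths into v share an arc and λ(s,v) ≤ 1; with this, (1)–(4) show that every arc's code
-- is spanned at its tail and every receiver decodes its layers.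

module Submission where

open import Defs
open import Level using (0ℓ)
open import Function using (_∘_; case_of_)
open import Data.Empty using (⊥; ⊥-elim)
open import Data.Product using (_×_; _,_; ∃; ∃₂; Σ; proj₁; proj₂)
open import Data.Product.Relation.Binary.Pointwise.NonDependent using (×-setoid)
open import Data.Sum using (_⊎_; inj₁; inj₂)
open import Data.Nat as Nat using (ℕ; zero; suc; _≤_; _<_; z≤n; s≤s)
import Data.Nat.Properties as ℕ
open import Data.Fin as Fin using (Fin; _≟_; toℕ)
open import Data.Fin.Patterns using (0F; 1F)
import Data.Fin.Properties as FinP
open import Data.Fin.Subset using () renaming (_∈_ to _∈ₛ_)
open import Data.List using (List; []; _∷_; _++_; [_]; length; map; concatMap; allFin)
open import Data.List.Membership.Propositional using (_∉_; lose)
open import Data.List.Membership.Propositional.Properties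
  using (∈-++⁺ˡ; ∈-++⁺ʳ; ∈-++⁻; ∈-map⁺; ∈-concatMap⁺; ∈-allFin; ∈-filter⁺; ∈-filter⁻)
open import Data.List.Relation.Unary.Any using (here; there)
import Data.List.Relation.Unary.Any as Any
open import Data.List.Relation.Unary.All using (All; []; _∷_)
import Data.List.Relation.Unary.All as All
open import Data.List.Relation.Unary.AllPairs using ([]; _∷_)
open import Data.List.Relation.Unary.Unique.Propositional using (Unique)
import Data.List.Relation.Unary.Unique.Propositional.Properties as Unique
open import Data.List.Relation.Binary.Disjoint.Propositional using (Disjoint)
import Data.List.Relation.Binary.Disjoint.DecPropositional as DecDisjoint
open import Data.Vec using (Vec; lookup; []; _∷_)
open import Data.Vec.Relation.Unary.All using ([])
import Data.Vec.Relation.Unary.All.Properties as VecAll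
open import Data.Vec.Relation.Unary.AllPairs using ([]; _∷_)
open import Data.Vec.Relation.Unary.Unique.Propositional using () renaming (Unique to UniqueVec)
import Data.Vec.Relation.Unary.Unique.Propositional.Properties as VecUnique
open import Relation.Nullary using (¬_; Dec; yes; no)
open import Relation.Nullary.Decidable using (map′; _×-dec_; _⊎-dec_; ¬?; decidable-stable)
open import Relation.Nullary.Negation using (¬¬-Monad)
open import Effect.Monad using (RawMonad)
open import Relation.Binary.PropositionalEquality using (_≡_; _≢_; refl; sym; trans; cong; subst)
import Relation.Binary.Bundles
import Relation.Binary.Reasoning.Setoid as SetoidReasoning
open import Induction.WellFounded using (Acc; acc; WellFounded; WfRec)
import Induction.WellFounded as WF
import Algebra.Bundles
import Algebra.Properties.Group as GroupProperties
import Algebra.Properties.AbelianGroup as AbelianGroupProperties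
import Algebra.Properties.CommutativeSemigroup as CommutativeSemigroupProperties
import Algebra.Properties.RingWithoutOne as RingWithoutOneProperties

module Walks (G : Digraph) where
  open import Data.List.Membership.Propositional using (_∈_)
  open Digraph G

  infixr 5 _++ʷ_

  _++ʷ_ : ∀ {x y z} → Walk G x y → Walk G y z → Walk G x z
  []      ++ʷ q = q
  (a ∷ p) ++ʷ q = a ∷ (p ++ʷ q)

  arcsOf-++ʷ : ∀ {x y z} (p : Walk G x y) (q : Walk G y z) →
               arcsOf G (p ++ʷ q) ≡ arcsOf G p ++ arcsOf G q
  arcsOf-++ʷ []      q = refl
  arcsOf-++ʷ (a ∷ p) q = cong (a ∷_) (arcsOf-++ʷ p q)

  ≡⇒walk : ∀ {x y} → x ≡ y → Walk G x y
  ≡⇒walk refl = []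

  snoc : ∀ {x v} a → head a ≡ v → Walk G x (tail a) → Walk G x v
  snoc a refl w = w ++ʷ (a ∷ [])

  arcsOf-snoc : ∀ {x v} a (e : head a ≡ v) (w : Walk G x (tail a)) →
                arcsOf G (snoc a e w) ≡ arcsOf G w ++ [ a ]
  arcsOf-snoc a refl w = arcsOf-++ʷ w (a ∷ [])

  ∈-snoc⁻ : ∀ {x v b} a (e : head a ≡ v) (w : Walk G x (tail a)) →
            b ∈ arcsOf G (snoc a e w) → b ∈ a ∷ arcsOf G w
  ∈-snoc⁻ a e w b∈ with ∈-++⁻ (arcsOf G w) (subst (_ ∈_) (arcsOf-snoc a e w) b∈)
  ... | inj₁ b∈w       = there b∈w
  ... | inj₂ (here b≡a) = here b≡a

  ∈-snoc⁺ : ∀ {x v b} a (e : head a ≡ v) (w : Walk G x (tail a)) →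
            b ∈ a ∷ arcsOf G w → b ∈ arcsOf G (snoc a e w)
  ∈-snoc⁺ a e w b∈ = subst (_ ∈_) (sym (arcsOf-snoc a e w)) (∈-a∷w⇒∈-w∷ʳa b∈)
    where
    ∈-a∷w⇒∈-w∷ʳa : ∀ {b} → b ∈ a ∷ arcsOf G w → b ∈ arcsOf G w ++ [ a ]
    ∈-a∷w⇒∈-w∷ʳa (here b≡a)  = ∈-++⁺ʳ (arcsOf G w) (here b≡a)
    ∈-a∷w⇒∈-w∷ʳa (there b∈w) = ∈-++⁺ˡ b∈w

  suffixAfter : ∀ {x y b} (w : Walk G x y) → b ∈ arcsOf G w → Walk G (head b) y
  suffixAfter (a ∷ w) (here refl) = w
  suffixAfter (a ∷ w) (there b∈w) = suffixAfter w b∈w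

  data LastArc {x : Node G} : ∀ {y} → Walk G x y → Set where
    none : LastArc []
    last : ∀ a (w : Walk G x (tail a)) → LastArc (snoc a refl w)

  lastArc : ∀ {x y} (w : Walk G x y) → LastArc w
  lastArc []      = none
  lastArc (a ∷ w) with lastArc w
  ... | none     = last a []
  ... | last b w′ = last b (a ∷ w′)

  nodesOf : ∀ {x y} (w : Walk G x y) → Vec (Node G) (suc (length (arcsOf G w)))
  nodesOf {x} []      = x ∷ []
  nodesOf     (a ∷ w) = tail a ∷ nodesOf w

  prefixTo : ∀ {x y} (w : Walk G x y) i → Walk G x (lookup (nodesOf w) i)
  prefixTo []      Fin.zero    = []
  prefixTo (a ∷ w) Fin.zero    = []
  prefixTo (a ∷ w) (Fin.suc i) = a ∷ prefixTo w i

  module _ (u : Node G) where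
    trivialWalks : ∀ {x} → Dec (x ≡ u) → List (Walk G x u)
    trivialWalks (yes refl) = [ [] ]
    trivialWalks (no _)     = []

    walksTo : ℕ → ∀ x → List (Walk G x u)
    extendBy : ℕ → ∀ {x} a → Dec (tail a ≡ x) → List (Walk G x u)
    walksTo zero    x = trivialWalks (x ≟ u)
    walksTo (suc k) x =
      trivialWalks (x ≟ u) ++ concatMap (λ a → extendBy k a (tail a ≟ x)) (allFin m)
    extendBy k a (yes refl) = map (a ∷_) (walksTo k (head a))
    extendBy k a (no _)     = []

    ∈-trivialWalks : (u≟u : Dec (u ≡ u)) → [] ∈ trivialWalks u≟u
    ∈-trivialWalks (yes refl) = here refl
    ∈-trivialWalks (no u≢u)   = ⊥-elim (u≢u refl)

    ∈-walksTo : ∀ {k x} (w : Walk G x u) → length (arcsOf G w) ≤ k → w ∈ walksTo k x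
    ∈-walksTo {zero}  []      _        = ∈-trivialWalks (u ≟ u)
    ∈-walksTo {suc k} []      _        = ∈-++⁺ˡ (∈-trivialWalks (u ≟ u))
    ∈-walksTo {suc k} (a ∷ w) (s≤s ≤k) =
      ∈-++⁺ʳ _ (∈-concatMap⁺ (λ b → extendBy k b (tail b ≟ tail a))
                 (Any.map (λ { refl → ∈-extendBy (tail a ≟ tail a) }) (∈-allFin a)))
      where
      ∈-extendBy : (d : Dec (tail a ≡ tail a)) → a ∷ w ∈ extendBy k a d
      ∈-extendBy (yes refl)  = ∈-map⁺ (a ∷_) (∈-walksTo w ≤k)
      ∈-extendBy (no ta≢ta) = ⊥-elim (ta≢ta refl)

  twoDisjointPaths : ∀ {x v} (p q : Walk G x v) → Disjoint (arcsOf G p) (arcsOf G q) →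
                     DisjointPaths G x v 2
  twoDisjointPaths {x} {v} p q p#q = P , P#P
    where
    P : Fin 2 → Walk G x v
    P 0F = p
    P 1F = q
    P#P : ∀ i j → i ≢ j → ∀ a → a ∈ arcsOf G (P i) → a ∈ arcsOf G (P j) → ⊥
    P#P 0F 0F i≢j = ⊥-elim (i≢j refl)
    P#P 0F 1F _ a a∈p a∈q = p#q (a∈p , a∈q)
    P#P 1F 0F _ a a∈q a∈p = p#q (a∈p , a∈q)
    P#P 1F 1F i≢j = ⊥-elim (i≢j refl)

module AcyclicWalks (G : Digraph) (acyclic : Acyclic G) where
  open import Data.List.Membership.Propositional using (_∈_)
  open Digraph G
  open Walks G

  no-walk-back : ∀ a → ¬ Walk G (head a) (tail a)
  no-walk-back a w with acyclic (tail a) (a ∷ w)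
  ... | ()

  ∉-closedWalk : ∀ {x y b} → y ≡ x → (w : Walk G x y) → b ∉ arcsOf G w
  ∉-closedWalk refl w b∈w with subst (_ ∈_) (acyclic _ w) b∈w
  ... | ()

  nodesOf-unique : ∀ {x y} (w : Walk G x y) → UniqueVec (nodesOf w)
  nodesOf-unique []      = [] ∷ []
  nodesOf-unique (a ∷ w) =
    VecAll.lookup⁻ (λ i tail≡ → no-walk-back a (subst (Walk G _) (sym tail≡) (prefixTo w i)))
    ∷ nodesOf-unique w

  length<n : ∀ {x y} (w : Walk G x y) → length (arcsOf G w) < n
  length<n w = FinP.injective⇒≤ (VecUnique.lookup-injective (nodesOf-unique w) _ _)

  Feeds : Arc G → Arc G → Set
  Feeds b a = head b ≡ tail a

  feeds-wellFounded : WellFounded Feeds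
  feeds-wellFounded a = acc-ending-at n a refl [] (ℕ.n≤1+n n)
    where
    acc-ending-at : ∀ k {x v} a → head a ≡ x → (w : Walk G x v) →
                    n ≤ suc (length (arcsOf G w)) Nat.+ k → Acc Feeds a
    acc-ending-at zero    a refl w n≤ =
      ⊥-elim (ℕ.<⇒≱ (length<n (a ∷ w)) (subst (n ≤_) (ℕ.+-identityʳ _) n≤))
    acc-ending-at (suc k) a refl w n≤ =
      acc λ b↝a → acc-ending-at k _ b↝a (a ∷ w) (subst (n ≤_) (ℕ.+-suc _ k) n≤)

  disjointPaths? : ∀ s v → Dec (DisjointPaths G s v 2)
  disjointPaths? s v =
    map′ fromWitness toWitness
      (Any.any? (λ p → Any.any? (λ q → disjoint? (arcsOf G p) (arcsOf G q)) candidates) candidates)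
    where
    open DecDisjoint (_≟_ {m}) using (disjoint?)
    candidates : List (Walk G s v)
    candidates = walksTo v n s
    Witness : Set
    Witness = Any.Any (λ p → Any.Any (λ q → Disjoint (arcsOf G p) (arcsOf G q)) candidates)
                      candidates
    fromWitness : Witness → DisjointPaths G s v 2
    fromWitness found with Any.satisfied found
    ... | p , found′ with Any.satisfied found′
    ...   | q , p#q = twoDisjointPaths p q p#q
    toWitness : DisjointPaths G s v 2 → Witness
    toWitness (P , P#P) = lose (∈-candidate (P 0F)) (lose (∈-candidate (P 1F))
                            (λ (a∈p , a∈q) → P#P 0F 1F (λ ()) _ a∈p a∈q))
      where
      ∈-candidate : (w : Walk G s v) → w ∈ candidates
      ∈-candidate w = ∈-walksTo v w (ℕ.<⇒≤ (length<n w))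

module InArcs (G : Digraph) where
  open import Data.List.Membership.Propositional using (_∈_)
  open Digraph G

  ∈-inArcs⁺ : ∀ {u a} → head a ≡ u → a ∈ inArcs G u
  ∈-inArcs⁺ {u} {a} = ∈-filter⁺ (λ b → head b ≟ u) (∈-allFin a)

  ∈-inArcs⁻ : ∀ {u a} → a ∈ inArcs G u → head a ≡ u
  ∈-inArcs⁻ {u} a∈ = proj₂ (∈-filter⁻ (λ b → head b ≟ u) {xs = allFin m} a∈)

  inArcs-unique : ∀ u → Unique (inArcs G u)
  inArcs-unique u = Unique.filter⁺ (λ b → head b ≟ u) (Unique.allFin⁺ m)

module CodeAlgebra (G : Digraph) (F : Field) where
  open import Data.List.Membership.Propositional using (_∈_)
  open Digraph G using (m; head)
  open InArcs G
  open Field F hiding (refl; sym; trans)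
  open Field F using () renaming (refl to ≈-refl; sym to ≈-sym; trans to ≈-trans)

  open SetoidReasoning setoid
  open GroupProperties +-group using (ε⁻¹≈ε; x∙y⁻¹≈ε⇒x≈y)
  open AbelianGroupProperties +-abelianGroup using (⁻¹-anti-homo‿-; ⁻¹-∙-comm)
  open CommutativeSemigroupProperties +-commutativeSemigroup using (interchange)
  open RingWithoutOneProperties (Algebra.Bundles.Ring.ringWithoutOne ring)
    using (x[y-z]≈xy-xz; -‿distribˡ-*)

  V : Set
  V = Vec2 G F

  infix  4 _≈ᵥ_
  infixl 6 _+ᵥ_
  infixl 7 _·ᵥ_

  _≈ᵥ_ : V → V → Set
  _≈ᵥ_ = _≈²_ G F

  _·ᵥ_ : Carrier → V → V
  _·ᵥ_ = _·_ G F

  _+ᵥ_ : V → V → V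
  _+ᵥ_ = _⊕_ G F

  e₁ e₂ : V
  e₁ = unit G F 1
  e₂ = unit G F 2

  0ᵥ : V
  0ᵥ = zero² G F

  open Relation.Binary.Bundles.Setoid (×-setoid setoid setoid) public
    using () renaming (refl to ≈ᵥ-refl; sym to ≈ᵥ-sym; trans to ≈ᵥ-trans)

  1≉0 : ¬ 1# ≈ 0#
  1≉0 = 0≉1 ∘ ≈-sym

  *-nonzero : ∀ {x y} → ¬ x ≈ 0# → ¬ y ≈ 0# → ¬ x * y ≈ 0#
  *-nonzero {x} {y} x≉0 y≉0 xy≈0 with inverse y y≉0
  ... | y⁻¹ , yy⁻¹≈1 = x≉0 (begin
    x             ≈⟨ *-identityʳ x ⟨
    x * 1#        ≈⟨ *-congˡ yy⁻¹≈1 ⟨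
    x * (y * y⁻¹) ≈⟨ *-assoc x y y⁻¹ ⟨
    x * y * y⁻¹   ≈⟨ *-congʳ xy≈0 ⟩
    0# * y⁻¹      ≈⟨ zeroˡ y⁻¹ ⟩
    0#            ∎)

  det : V → V → Carrier
  det (x₁ , x₂) (y₁ , y₂) = x₁ * y₂ - x₂ * y₁

  det-self : ∀ x → det x x ≈ 0#
  det-self (x₁ , x₂) = ≈-trans (+-congˡ (-‿cong (*-comm x₂ x₁))) (-‿inverseʳ (x₁ * x₂))

  det-antisym : ∀ x y → det x y ≈ 0# → det y x ≈ 0#
  det-antisym (x₁ , x₂) (y₁ , y₂) det≈0 = begin
    y₁ * x₂ - y₂ * x₁       ≈⟨ +-cong (*-comm y₁ x₂) (-‿cong (*-comm y₂ x₁)) ⟩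
    x₂ * y₁ - x₁ * y₂       ≈⟨ ⁻¹-anti-homo‿- (x₁ * y₂) (x₂ * y₁) ⟨
    - (x₁ * y₂ - x₂ * y₁)   ≈⟨ -‿cong det≈0 ⟩
    - 0#                    ≈⟨ ε⁻¹≈ε ⟩
    0#                      ∎

  det-nonzero : ∀ {x₁ x₂ y₁ y₂} → x₂ ≈ 0# → ¬ x₁ ≈ 0# → ¬ y₂ ≈ 0# → ¬ det (x₁ , x₂) (y₁ , y₂) ≈ 0#
  det-nonzero {x₁} {x₂} {y₁} {y₂} x₂≈0 x₁≉0 y₂≉0 det≈0 = *-nonzero x₁≉0 y₂≉0 (begin
    x₁ * y₂            ≈⟨ +-identityʳ (x₁ * y₂) ⟨
    x₁ * y₂ + 0#       ≈⟨ +-congˡ ε⁻¹≈ε ⟨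
    x₁ * y₂ - 0#       ≈⟨ +-congˡ (-‿cong (≈-trans (*-congʳ x₂≈0) (zeroˡ y₁))) ⟨
    x₁ * y₂ - x₂ * y₁  ≈⟨ det≈0 ⟩
    0#                 ∎)

  record LinearForm : Set where
    field
      form        : V → Carrier
      form-cong   : ∀ {x y} → x ≈ᵥ y → form x ≈ form y
      form-zero   : form 0ᵥ ≈ 0#
      form-linear : ∀ β x r → form (β ·ᵥ x +ᵥ r) ≈ β * form x + form r
  open LinearForm public

  second : LinearForm
  second = record
    { form        = proj₂
    ; form-cong   = proj₂
    ; form-zero   = ≈-refl
    ; form-linear = λ _ _ _ → ≈-refl
    }

  det-against : V → LinearForm
  det-against (y₁ , y₂) = record
    { form        = λ x → det x (y₁ , y₂)
    ; form-cong   = λ (x₁≈ , x₂≈) → +-cong (*-congʳ x₁≈) (-‿cong (*-congʳ x₂≈))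
    ; form-zero   = ≈-trans (+-cong (zeroˡ y₂) (-‿cong (zeroˡ y₁))) (-‿inverseʳ 0#)
    ; form-linear = λ β x r → linear β (proj₁ x) (proj₂ x) (proj₁ r) (proj₂ r)
    }
    where
    linear : ∀ β x₁ x₂ r₁ r₂ →
      (β * x₁ + r₁) * y₂ - (β * x₂ + r₂) * y₁ ≈ β * (x₁ * y₂ - x₂ * y₁) + (r₁ * y₂ - r₂ * y₁)
    linear β x₁ x₂ r₁ r₂ = begin
      (β * x₁ + r₁) * y₂ - (β * x₂ + r₂) * y₁
        ≈⟨ +-cong (distribʳ y₂ (β * x₁) r₁) (-‿cong (distribʳ y₁ (β * x₂) r₂)) ⟩
      (β * x₁ * y₂ + r₁ * y₂) - (β * x₂ * y₁ + r₂ * y₁)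
        ≈⟨ +-congˡ (⁻¹-∙-comm (β * x₂ * y₁) (r₂ * y₁)) ⟨
      (β * x₁ * y₂ + r₁ * y₂) + (- (β * x₂ * y₁) + - (r₂ * y₁))
        ≈⟨ interchange (β * x₁ * y₂) (r₁ * y₂) (- (β * x₂ * y₁)) (- (r₂ * y₁)) ⟩
      (β * x₁ * y₂ - β * x₂ * y₁) + (r₁ * y₂ - r₂ * y₁)
        ≈⟨ +-congʳ (+-cong (*-assoc β x₁ y₂) (-‿cong (*-assoc β x₂ y₁))) ⟩
      (β * (x₁ * y₂) - β * (x₂ * y₁)) + (r₁ * y₂ - r₂ * y₁)
        ≈⟨ +-congʳ (x[y-z]≈xy-xz β (x₁ * y₂) (x₂ * y₁)) ⟨
      β * (x₁ * y₂ - x₂ * y₁) + (r₁ * y₂ - r₂ * y₁)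
        ∎

  vanishes-on-lincomb : ∀ (φ : LinearForm) {c} β {L} →
                        All (λ a → form φ (c a) ≈ 0#) L → form φ (lincomb G F β c L) ≈ 0#
  vanishes-on-lincomb φ β                  []              = form-zero φ
  vanishes-on-lincomb φ {c} β {a ∷ L} (φca≈0 ∷ φL≈0) = begin
    form φ (β a ·ᵥ c a +ᵥ lincomb G F β c L)
      ≈⟨ form-linear φ (β a) (c a) _ ⟩
    β a * form φ (c a) + form φ (lincomb G F β c L)
      ≈⟨ +-cong (*-congˡ φca≈0) (vanishes-on-lincomb φ β φL≈0) ⟩
    β a * 0# + 0#
      ≈⟨ +-identityʳ _ ⟩
    β a * 0#
      ≈⟨ zeroʳ (β a) ⟩
    0#
      ∎

  vanishes-on-span : ∀ (φ : LinearForm) {c u x} → (∀ a → head a ≡ u → form φ (c a) ≈ 0#) →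
                     InSpanIn G F c u x → form φ x ≈ 0#
  vanishes-on-span φ φc≈0 (β , x≈) =
    ≈-trans (form-cong φ x≈) (vanishes-on-lincomb φ β (All.tabulate (λ a∈ → φc≈0 _ (∈-inArcs⁻ a∈))))

  nonvanishing-on-inArc : ∀ (φ : LinearForm) {c u x} → InSpanIn G F c u x → ¬ form φ x ≈ 0# →
                          ¬ ¬ (∃ λ a → head a ≡ u × ¬ form φ (c a) ≈ 0#)
  nonvanishing-on-inArc φ (β , x≈) φx≉0 ¬found =
    All.sequenceM _ ¬¬-Monad (All.tabulate (λ a∈ φca≉0 → ¬found (_ , ∈-inArcs⁻ a∈ , φca≉0)))
      (λ φc≈0 → φx≉0 (≈-trans (form-cong φ x≈) (vanishes-on-lincomb φ β φc≈0)))

  span-resp : ∀ {c u x y} → x ≈ᵥ y → InSpanIn G F c u y → InSpanIn G F c u x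
  span-resp x≈y (β , y≈) = β , ≈ᵥ-trans x≈y y≈

  lincomb-combine : ∀ α γ β β′ c L →
    lincomb G F (λ a → α * β a + γ * β′ a) c L ≈ᵥ α ·ᵥ lincomb G F β c L +ᵥ γ ·ᵥ lincomb G F β′ c L
  lincomb-combine α γ β β′ c []      = zero-combination , zero-combination
    where
    zero-combination : 0# ≈ α * 0# + γ * 0#
    zero-combination = ≈-sym (≈-trans (+-cong (zeroʳ α) (zeroʳ γ)) (+-identityʳ 0#))
  lincomb-combine α γ β β′ c (a ∷ L) =
    combination-step (proj₁ (c a)) (proj₁ ih) , combination-step (proj₂ (c a)) (proj₂ ih)
    where
    ih : lincomb G F (λ a → α * β a + γ * β′ a) c L
         ≈ᵥ α ·ᵥ lincomb G F β c L +ᵥ γ ·ᵥ lincomb G F β′ c L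
    ih = lincomb-combine α γ β β′ c L
    combination-step : ∀ x {R S T} → R ≈ α * S + γ * T →
      (α * β a + γ * β′ a) * x + R ≈ α * (β a * x + S) + γ * (β′ a * x + T)
    combination-step x {R} {S} {T} R≈ = begin
      (α * β a + γ * β′ a) * x + R                ≈⟨ +-cong (distribʳ x (α * β a) (γ * β′ a)) R≈ ⟩
      (α * β a * x + γ * β′ a * x) + (α * S + γ * T)
        ≈⟨ +-congʳ (+-cong (*-assoc α (β a) x) (*-assoc γ (β′ a) x)) ⟩
      (α * (β a * x) + γ * (β′ a * x)) + (α * S + γ * T)
        ≈⟨ interchange (α * (β a * x)) (γ * (β′ a * x)) (α * S) (γ * T) ⟩
      (α * (β a * x) + α * S) + (γ * (β′ a * x) + γ * T)
        ≈⟨ +-cong (distribˡ α (β a * x) S) (distribˡ γ (β′ a * x) T) ⟨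
      α * (β a * x + S) + γ * (β′ a * x + T)      ∎

  span-combine : ∀ {c u x y} α γ → InSpanIn G F c u x → InSpanIn G F c u y →
                 InSpanIn G F c u (α ·ᵥ x +ᵥ γ ·ᵥ y)
  span-combine {c} {u} α γ (β , x≈) (β′ , y≈) =
    (λ a → α * β a + γ * β′ a) ,
    ≈ᵥ-trans (combine-cong x≈ y≈) (≈ᵥ-sym (lincomb-combine α γ β β′ c (inArcs G u)))
    where
    combine-cong : ∀ {x x′ y y′} → x ≈ᵥ x′ → y ≈ᵥ y′ → α ·ᵥ x +ᵥ γ ·ᵥ y ≈ᵥ α ·ᵥ x′ +ᵥ γ ·ᵥ y′
    combine-cong (x₁≈ , x₂≈) (y₁≈ , y₂≈) =
      +-cong (*-congˡ x₁≈) (*-congˡ y₁≈) , +-cong (*-congˡ x₂≈) (*-congˡ y₂≈)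

  indicator : Arc G → Arc G → Carrier
  indicator b a with a ≟ b
  ... | yes _ = 1#
  ... | no  _ = 0#

  lincomb-indicator-∉ : ∀ c {b} L → b ∉ L → lincomb G F (indicator b) c L ≈ᵥ 0ᵥ
  lincomb-indicator-∉ c     []      _   = ≈ᵥ-refl
  lincomb-indicator-∉ c {b} (a ∷ L) b∉ with a ≟ b | lincomb-indicator-∉ c L (λ b∈ → b∉ (there b∈))
  ... | yes a≡b | _         = ⊥-elim (b∉ (here (sym a≡b)))
  ... | no  _   | (ih₁ , ih₂) =
    ≈-trans (+-cong (zeroˡ _) ih₁) (+-identityʳ 0#) ,
    ≈-trans (+-cong (zeroˡ _) ih₂) (+-identityʳ 0#)

  lincomb-indicator-∈ : ∀ c {b} L → Unique L → b ∈ L → lincomb G F (indicator b) c L ≈ᵥ c b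
  lincomb-indicator-∈ c {b} (a ∷ L) (a∉L ∷ _) (here refl) with a ≟ a
  ... | no a≢a = ⊥-elim (a≢a refl)
  ... | yes _  = one-plus-zero (proj₁ rest) , one-plus-zero (proj₂ rest)
    where
    rest : lincomb G F (indicator a) c L ≈ᵥ 0ᵥ
    rest = lincomb-indicator-∉ c L (λ a∈ → All.lookup a∉L a∈ refl)
    one-plus-zero : ∀ {x r} → r ≈ 0# → 1# * x + r ≈ x
    one-plus-zero {x} r≈0 = ≈-trans (+-cong (*-identityˡ x) r≈0) (+-identityʳ x)
  lincomb-indicator-∈ c {b} (a ∷ L) (a∉L ∷ L-unique) (there b∈L) with a ≟ b
  ... | yes refl = ⊥-elim (All.lookup a∉L b∈L refl)
  ... | no  _    = zero-plus (proj₁ rest) , zero-plus (proj₂ rest)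
    where
    rest : lincomb G F (indicator b) c L ≈ᵥ c b
    rest = lincomb-indicator-∈ c L L-unique b∈L
    zero-plus : ∀ {x r y} → r ≈ y → 0# * x + r ≈ y
    zero-plus {x} r≈y = ≈-trans (+-cong (zeroˡ x) r≈y) (+-identityˡ _)

  span-inArc : ∀ c {u b} → head b ≡ u → InSpanIn G F c u (c b)
  span-inArc c {u} {b} b↦u =
    indicator b , ≈ᵥ-sym (lincomb-indicator-∈ c (inArcs G u) (inArcs-unique u) (∈-inArcs⁺ b↦u))

  module _ {c : Arc G → V} {u : Node G} where

    span-e₂ : ∀ λ₀ → InSpanIn G F c u e₁ → InSpanIn G F c u (λ₀ , 1#) → InSpanIn G F c u e₂
    span-e₂ λ₀ e₁∈ v∈ = span-resp (≈₁ , ≈₂) (span-combine 1# (- λ₀) v∈ e₁∈)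
      where
      ≈₁ : 0# ≈ 1# * λ₀ + - λ₀ * 1#
      ≈₁ = ≈-sym (≈-trans (+-cong (*-identityˡ λ₀) (*-identityʳ (- λ₀))) (-‿inverseʳ λ₀))
      ≈₂ : 1# ≈ 1# * 1# + - λ₀ * 0#
      ≈₂ = ≈-sym (≈-trans (+-cong (*-identityˡ 1#) (zeroʳ (- λ₀))) (+-identityʳ 1#))

    span-e₁ : ∀ {λ₀ μ₀} → ¬ λ₀ ≈ μ₀ → InSpanIn G F c u (λ₀ , 1#) → InSpanIn G F c u (μ₀ , 1#) →
              InSpanIn G F c u e₁
    span-e₁ {λ₀} {μ₀} λ₀≉μ₀ λ∈ μ∈ with inverse (λ₀ - μ₀) (λ₀≉μ₀ ∘ x∙y⁻¹≈ε⇒x≈y λ₀ μ₀)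
    ... | d , [λ₀-μ₀]d≈1 = span-resp (≈₁ , ≈₂) (span-combine d (- d) λ∈ μ∈)
      where
      ≈₁ : 1# ≈ d * λ₀ + - d * μ₀
      ≈₁ = ≈-sym (begin
        d * λ₀ + - d * μ₀      ≈⟨ +-congˡ (-‿distribˡ-* d μ₀) ⟨
        d * λ₀ - d * μ₀        ≈⟨ x[y-z]≈xy-xz d λ₀ μ₀ ⟨
        d * (λ₀ - μ₀)          ≈⟨ *-comm d (λ₀ - μ₀) ⟩
        (λ₀ - μ₀) * d          ≈⟨ [λ₀-μ₀]d≈1 ⟩
        1#                     ∎)
      ≈₂ : 0# ≈ d * 1# + - d * 1#
      ≈₂ = ≈-sym (≈-trans (+-cong (*-identityʳ d) (*-identityʳ (- d))) (-‿inverseʳ d))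

    span-all : InSpanIn G F c u e₁ → InSpanIn G F c u e₂ → ∀ x → InSpanIn G F c u x
    span-all e₁∈ e₂∈ (x₁ , x₂) = span-resp (≈₁ , ≈₂) (span-combine x₁ x₂ e₁∈ e₂∈)
      where
      ≈₁ : x₁ ≈ x₁ * 1# + x₂ * 0#
      ≈₁ = ≈-sym (≈-trans (+-cong (*-identityʳ x₁) (zeroʳ x₂)) (+-identityʳ x₁))
      ≈₂ : x₂ ≈ x₁ * 0# + x₂ * 1#
      ≈₂ = ≈-sym (≈-trans (+-cong (zeroʳ x₁) (*-identityʳ x₂)) (+-identityˡ x₂))

module IndependentCodes (G : Digraph) (s : Node G) (acyclic : Acyclic G) (F : Field)
                        (c : Arc G → Vec2 G F) (linear : IsLinearNetworkCode G F s c) where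
  open import Data.List.Membership.Propositional using (_∈_)
  open Digraph G
  open Walks G
  open AcyclicWalks G acyclic
  open CodeAlgebra G F
  open Field F using (_≈_; 0#)
  open RawMonad (¬¬-Monad {0ℓ}) using (pure; _>>=_; _<$>_)

  Independent : Arc G → Arc G → Set
  Independent a b = ¬ det (c a) (c b) ≈ 0#

  independent-irrefl : ∀ {a b} → Independent a b → a ≢ b
  independent-irrefl {a} a⊥a refl = a⊥a (det-self (c a))

  independent-sym : ∀ {a b} → Independent a b → Independent b a
  independent-sym {a} {b} a⊥b det≈0 = a⊥b (det-antisym (c b) (c a) det≈0)

  DisjointRoutes : Arc G → Arc G → Set
  DisjointRoutes a b = Σ (Walk G s (tail a)) λ wa → Σ (Walk G s (tail b)) λ wb →
                       Disjoint (a ∷ arcsOf G wa) (b ∷ arcsOf G wb)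

  RoutedThrough : Arc G → Arc G → Set
  RoutedThrough a b = Σ (Walk G s (tail b)) λ wb → a ∈ arcsOf G wb

  swap-routes : ∀ {a b} → DisjointRoutes a b → DisjointRoutes b a
  swap-routes (wa , wb , a#b) = wb , wa , λ (x∈b , x∈a) → a#b (x∈a , x∈b)

  routes-from-source : ∀ {a b} → tail a ≡ s → tail b ≡ s → a ≢ b → DisjointRoutes a b
  routes-from-source {a} {b} ta≡s tb≡s a≢b = wa , wb , a#b
    where
    wa : Walk G s (tail a)
    wa = ≡⇒walk (sym ta≡s)
    wb : Walk G s (tail b)
    wb = ≡⇒walk (sym tb≡s)
    a#b : Disjoint (a ∷ arcsOf G wa) (b ∷ arcsOf G wb)
    a#b (here refl , here x≡b) = a≢b x≡b
    a#b (there x∈  , _)        = ∉-closedWalk ta≡s wa x∈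
    a#b (here _    , there x∈) = ∉-closedWalk tb≡s wb x∈

  ¬routed-to-source : ∀ {a b} → tail b ≡ s → ¬ RoutedThrough a b
  ¬routed-to-source tb≡s (wb , a∈wb) = ∉-closedWalk tb≡s wb a∈wb

  ¬mutually-routed : ∀ {a b} → RoutedThrough a b → ¬ RoutedThrough b a
  ¬mutually-routed {a} {b} (wb , a∈wb) (wa , b∈wa) =
    no-walk-back a (suffixAfter wb a∈wb ++ʷ b ∷ suffixAfter wa b∈wa)

  route-via : ∀ {a b w} → head w ≡ tail a → Independent a b → DisjointRoutes w b →
              DisjointRoutes a b ⊎ RoutedThrough a b
  route-via {a} {b} {w} w↦a a⊥b (ww , wb , w#b) with Any.any? (a ≟_) (b ∷ arcsOf G wb)
  ... | yes (here a≡b)   = ⊥-elim (independent-irrefl a⊥b a≡b)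
  ... | yes (there a∈wb) = inj₂ (wb , a∈wb)
  ... | no  a∉           = inj₁ (snoc w w↦a ww , wb , a#b)
    where
    a#b : Disjoint (a ∷ arcsOf G (snoc w w↦a ww)) (b ∷ arcsOf G wb)
    a#b (here refl , x∈b) = a∉ x∈b
    a#b (there x∈  , x∈b) = w#b (∈-snoc⁻ w w↦a ww x∈ , x∈b)

  -- If a lies on the route found for b, the roles of a and b are exchanged; a lying on b's
  -- route while b lies on a's would close a cycle.
  mutual
    routes : ∀ {a b} → Acc Feeds a → Acc Feeds b → Independent a b → ¬ ¬ DisjointRoutes a b
    routes {a} {b} acc-a acc-b a⊥b with tail a ≟ s | tail b ≟ s
    ... | yes ta≡s | yes tb≡s = pure (routes-from-source ta≡s tb≡s (independent-irrefl a⊥b))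
    ... | yes ta≡s | no  tb≢s =
      swap-routes <$> routes-unless acc-b acc-a (independent-sym a⊥b) tb≢s
                        (⊥-elim ∘ ¬routed-to-source ta≡s)
    ... | no  ta≢s | yes tb≡s =
      routes-unless acc-a acc-b a⊥b ta≢s (⊥-elim ∘ ¬routed-to-source tb≡s)
    ... | no  ta≢s | no  tb≢s =
      routes-unless acc-a acc-b a⊥b ta≢s λ a-on-b →
        swap-routes <$> routes-unless acc-b acc-a (independent-sym a⊥b) tb≢s
                          (⊥-elim ∘ ¬mutually-routed a-on-b)

    routes-unless : ∀ {a b} → Acc Feeds a → Acc Feeds b → Independent a b → tail a ≢ s →
                    (RoutedThrough a b → ¬ ¬ DisjointRoutes a b) → ¬ ¬ DisjointRoutes a b
    routes-unless {a} {b} (acc feeders) acc-b a⊥b ta≢s otherwise = do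
      w , w↦a , w⊥b ← nonvanishing-on-inArc (det-against (c b)) (linear a ta≢s) a⊥b
      w#b ← routes (feeders w↦a) acc-b w⊥b
      case route-via w↦a a⊥b w#b of λ where
        (inj₁ a#b)    → pure a#b
        (inj₂ a-on-b) → otherwise a-on-b

  twoDisjointPaths-into : ∀ {u a b} → head a ≡ u → head b ≡ u → DisjointRoutes a b →
                          DisjointPaths G s u 2
  twoDisjointPaths-into {a = a} {b} a↦u b↦u (wa , wb , a#b) =
    twoDisjointPaths (snoc a a↦u wa) (snoc b b↦u wb)
      (λ (x∈a , x∈b) → a#b (∈-snoc⁻ a a↦u wa x∈a , ∈-snoc⁻ b b↦u wb x∈b))

  ¬¬disjointPaths-from-height-drop :
    ∀ {u x} → (∃ λ b → head b ≡ u) → (∀ b → head b ≡ u → HeightIs G F (c b) 2) →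
    InSpanIn G F c u x → HeightIs G F x 1 → ¬ ¬ DisjointPaths G s u 2
  ¬¬disjointPaths-from-height-drop (b₀ , b₀↦u) high x∈ (h1 x₂≈0 x₁≉0) with high b₀ b₀↦u
  ... | h2 b₀₂≉0 = do
    w , w↦u , w⊥b₀ ← nonvanishing-on-inArc (det-against (c b₀)) x∈ (det-nonzero x₂≈0 x₁≉0 b₀₂≉0)
    w#b₀ ← routes (feeds-wellFounded w) (feeds-wellFounded b₀) w⊥b₀
    pure (twoDisjointPaths-into w↦u b₀↦u w#b₀)

module InArcHeights (G : Digraph) (f : Arc G → ℕ) (f∈12 : ∀ a → f a ≡ 1 ⊎ f a ≡ 2) where
  open import Data.List.Membership.Propositional using (_∈_)
  open Digraph G
  open InArcs G

  HasInArc : Node G → ℕ → Set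
  HasInArc u k = ∃ λ b → head b ≡ u × f b ≡ k

  hasInArc? : ∀ u k → Dec (HasInArc u k)
  hasInArc? u k = FinP.any? (λ b → (head b ≟ u) ×-dec (f b ℕ.≟ k))

  hasInArc⇒∈inArcs : ∀ {u k} → HasInArc u k → ∃ λ b → b ∈ inArcs G u × f b ≡ k
  hasInArc⇒∈inArcs (b , b↦u , fb≡k) = b , ∈-inArcs⁺ b↦u , fb≡k

  ¬HasInArc-1⇒height-2 : ∀ {u} → ¬ HasInArc u 1 → ∀ b → head b ≡ u → f b ≡ 2
  ¬HasInArc-1⇒height-2 ¬h b b↦u with f∈12 b
  ... | inj₁ fb≡1 = ⊥-elim (¬h (b , b↦u , fb≡1))
  ... | inj₂ fb≡2 = fb≡2

  ¬HasInArc-2⇒height-1 : ∀ {u} → ¬ HasInArc u 2 → ∀ b → head b ≡ u → f b ≡ 1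
  ¬HasInArc-2⇒height-1 ¬h b b↦u with f∈12 b
  ... | inj₁ fb≡1 = fb≡1
  ... | inj₂ fb≡2 = ⊥-elim (¬h (b , b↦u , fb≡2))

module Necessity (G : Digraph) (s : Node G) (acyclic : Acyclic G) (single-source : SingleSource G s)
                 (f : Arc G → ℕ) (f∈12 : ∀ a → f a ≡ 1 ⊎ f a ≡ 2)
                 (F : Field) (c : Arc G → Vec2 G F) (linear : IsLinearNetworkCode G F s c)
                 (heights : ∀ a → HeightIs G F (c a) (f a)) where
  open import Data.List.Membership.Propositional using (_∈_)
  open Digraph G
  open AcyclicWalks G acyclic
  open CodeAlgebra G F
  open IndependentCodes G s acyclic F c linear
  open InArcHeights G f f∈12
  open Field F using (_≈_; 0#) renaming (refl to ≈-refl)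

  height-of : ∀ {k} a → f a ≡ k → HeightIs G F (c a) k
  height-of a refl = heights a

  height-2-arrives : ∀ {u x} → InSpanIn G F c u x → HeightIs G F x 2 → HasInArc u 2
  height-2-arrives {u} x∈ (h2 x₂≉0) with hasInArc? u 2
  ... | yes h = h
  ... | no ¬h = ⊥-elim (x₂≉0 (vanishes-on-span second low x∈))
    where
    low : ∀ b → head b ≡ u → proj₂ (c b) ≈ 0#
    low b b↦u with height-of b (¬HasInArc-2⇒height-1 ¬h b b↦u)
    ... | h1 cb₂≈0 _ = cb₂≈0

  height-1-arrives : ∀ {u x} → u ≢ s → InSpanIn G F c u x → HeightIs G F x 1 →
                     HasInArc u 1 ⊎ λ≥ G s u 2
  height-1-arrives {u} u≢s x∈ x-low with hasInArc? u 1 | disjointPaths? s u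
  ... | yes h  | _        = inj₁ h
  ... | no _   | yes two  = inj₂ two
  ... | no ¬h  | no ¬two  =
    ⊥-elim (¬¬disjointPaths-from-height-drop (proj₂ single-source u u≢s)
              (λ b b↦u → height-of b (¬HasInArc-1⇒height-2 ¬h b b↦u)) x∈ x-low ¬two)

  condition₁ : ∀ a → tail a ≢ s → f a ≡ 2 → HasInArc (tail a) 2
  condition₁ a ta≢s fa≡2 = height-2-arrives (linear a ta≢s) (height-of a fa≡2)

  condition₂ : ∀ a → tail a ≢ s → f a ≡ 1 → HasInArc (tail a) 1 ⊎ λ≥ G s (tail a) 2
  condition₂ a ta≢s fa≡1 = height-1-arrives ta≢s (linear a ta≢s) (height-of a fa≡1)

  module _ (τ : Demand G s)
           (performs : ∀ v → v ≢ s → ∀ d → DemandIs G τ v d → PerformanceAtLeast G F c v d) where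
    open Demand τ

    ∈T₁⇒≢s : ∀ {t} → t ∈ₛ T₁ → t ≢ s
    ∈T₁⇒≢s t∈T₁ refl = s∉T₁ t∈T₁

    ∈T₂⇒≢s : ∀ {t} → t ∈ₛ T₂ → t ≢ s
    ∈T₂⇒≢s t∈T₂ refl = s∉T₂ t∈T₂

    condition₃ : ∀ t → t ∈ₛ T₁ → λ≡ G s t 1 → ∃ λ b → b ∈ inArcs G t × f b ≡ 1
    condition₃ t t∈T₁ (_ , ¬two) with height-1-arrives t≢s e₁∈ (h1 ≈-refl 1≉0)
      where
      t≢s : t ≢ s
      t≢s = ∈T₁⇒≢s t∈T₁
      e₁∈ : InSpanIn G F c t e₁
      e₁∈ = performs t t≢s 1 (in₁ t∈T₁) 1 (s≤s z≤n) (s≤s z≤n)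
    ... | inj₁ has1 = hasInArc⇒∈inArcs has1
    ... | inj₂ two  = ⊥-elim (¬two two)

    condition₄ : ∀ t → t ∈ₛ T₂ → ∃ λ b → b ∈ inArcs G t × f b ≡ 2
    condition₄ t t∈T₂ = hasInArc⇒∈inArcs (height-2-arrives e₂∈ (h2 1≉0))
      where
      t≢s : t ≢ s
      t≢s = ∈T₂⇒≢s t∈T₂
      e₂∈ : InSpanIn G F c t e₂
      e₂∈ = performs t t≢s 2 (in₂ t∈T₂) 2 (s≤s z≤n) ℕ.≤-refl

module Origins (G : Digraph) (s : Node G) (acyclic : Acyclic G)
               (f : Arc G → ℕ) (f∈12 : ∀ a → f a ≡ 1 ⊎ f a ≡ 2) where
  open import Data.List.Membership.Propositional using (_∈_)
  open Digraph G
  open Walks G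
  open AcyclicWalks G acyclic
  open InArcHeights G f f∈12

  Saturated : Node G → (Arc G → Arc G) → Set
  Saturated u ℓ = (HasInArc u 1 × HasInArc u 2)
                ⊎ (∃₂ λ b b′ → head b ≡ u × head b′ ≡ u × f b ≡ 2 × f b′ ≡ 2 × ℓ b ≢ ℓ b′)

  saturated? : ∀ u ℓ → Dec (Saturated u ℓ)
  saturated? u ℓ = (hasInArc? u 1 ×-dec hasInArc? u 2) ⊎-dec
    FinP.any? (λ b → FinP.any? λ b′ → (head b ≟ u) ×-dec (head b′ ≟ u) ×-dec
      (f b ℕ.≟ 2) ×-dec (f b′ ℕ.≟ 2) ×-dec ¬? (ℓ b ≟ ℓ b′))

  AgreeOn : Node G → (Arc G → Arc G) → (Arc G → Arc G) → Set
  AgreeOn u ℓ ℓ′ = ∀ b → head b ≡ u → ℓ b ≡ ℓ′ b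

  saturated-resp : ∀ {u ℓ ℓ′} → AgreeOn u ℓ ℓ′ → Saturated u ℓ → Saturated u ℓ′
  saturated-resp ℓ≗ℓ′ (inj₁ mixed) = inj₁ mixed
  saturated-resp ℓ≗ℓ′ (inj₂ (b , b′ , b↦u , b′↦u , fb , fb′ , ℓb≢ℓb′)) =
    inj₂ (b , b′ , b↦u , b′↦u , fb , fb′ , λ ℓ′b≡ℓ′b′ →
      ℓb≢ℓb′ (trans (ℓ≗ℓ′ b b↦u) (trans ℓ′b≡ℓ′b′ (sym (ℓ≗ℓ′ b′ b′↦u)))))

  pick : ∀ a (ℓ : Arc G → Arc G) → Dec (tail a ≡ s) → Dec (Saturated (tail a) ℓ) →
         Dec (HasInArc (tail a) 2) → Arc G
  pick a ℓ (yes _) _       _               = a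
  pick a ℓ (no _)  (yes _) _               = a
  pick a ℓ (no _)  (no _)  (yes (b , _ , _)) = ℓ b
  pick a ℓ (no _)  (no _)  (no _)          = a

  choose : Arc G → (Arc G → Arc G) → Arc G
  choose a ℓ = pick a ℓ (tail a ≟ s) (saturated? (tail a) ℓ) (hasInArc? (tail a) 2)

  choose-cong : ∀ a {ℓ ℓ′} → AgreeOn (tail a) ℓ ℓ′ → choose a ℓ ≡ choose a ℓ′
  choose-cong a {ℓ} {ℓ′} ℓ≗ℓ′ =
    pick-cong (tail a ≟ s) (saturated? (tail a) ℓ) (saturated? (tail a) ℓ′) (hasInArc? (tail a) 2)
    where
    ℓ′≗ℓ : AgreeOn (tail a) ℓ′ ℓ
    ℓ′≗ℓ b b↦ = sym (ℓ≗ℓ′ b b↦)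
    pick-cong : ∀ d₀ d d′ d₂ → pick a ℓ d₀ d d₂ ≡ pick a ℓ′ d₀ d′ d₂
    pick-cong (yes _) _         _          _                 = refl
    pick-cong (no _)  (yes _)   (yes _)    _                 = refl
    pick-cong (no _)  (yes sat) (no ¬sat′) _ = ⊥-elim (¬sat′ (saturated-resp ℓ≗ℓ′ sat))
    pick-cong (no _)  (no ¬sat) (yes sat′) _ = ⊥-elim (¬sat (saturated-resp ℓ′≗ℓ sat′))
    pick-cong (no _)  (no _)    (no _)     (yes (b , b↦ , _)) = ℓ≗ℓ′ b b↦
    pick-cong (no _)  (no _)    (no _)     (no _)            = refl

  -- IH only labels the arcs feeding a; any other arc gets a dummy label, never read by choose.
  restrict : ∀ a → WfRec Feeds (λ _ → Arc G) a → Arc G → Arc G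
  restrict a IH b with head b ≟ tail a
  ... | yes b↝a = IH b↝a
  ... | no  _   = b

  originStep : ∀ a → WfRec Feeds (λ _ → Arc G) a → Arc G
  originStep a IH = choose a (restrict a IH)

  originStep-cong : ∀ a {IH IH′ : WfRec Feeds (λ _ → Arc G) a} →
                    (∀ {b} (b↝a : Feeds b a) → IH b↝a ≡ IH′ b↝a) →
                    originStep a IH ≡ originStep a IH′
  originStep-cong a {IH} {IH′} IH≗IH′ = choose-cong a restrict-agrees
    where
    restrict-agrees : AgreeOn (tail a) (restrict a IH) (restrict a IH′)
    restrict-agrees b _ with head b ≟ tail a
    ... | yes b↝a = IH≗IH′ b↝a
    ... | no  _   = refl

  origin : Arc G → Arc G
  origin = WF.All.wfRec feeds-wellFounded 0ℓ (λ _ → Arc G) originStep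

  origin-unfold : ∀ a → origin a ≡ choose a origin
  origin-unfold a =
    trans (WF.FixPoint.unfold-wfRec feeds-wellFounded (λ _ → Arc G) originStep originStep-cong)
          (choose-cong a restrict-origin)
    where
    restrict-origin : AgreeOn (tail a) (restrict a (λ _ → origin _)) origin
    restrict-origin b b↝a with head b ≟ tail a
    ... | yes _    = refl
    ... | no  b↝̸a = ⊥-elim (b↝̸a b↝a)

  module _ {u} (unsat : ¬ Saturated u origin) where

    same-origin : ∀ {b b′} → head b ≡ u → head b′ ≡ u → f b ≡ 2 → f b′ ≡ 2 → origin b ≡ origin b′
    same-origin {b} {b′} b↦u b′↦u fb≡2 fb′≡2 =
      decidable-stable (origin b ≟ origin b′)
        (λ ob≢ob′ → unsat (inj₂ (b , b′ , b↦u , b′↦u , fb≡2 , fb′≡2 , ob≢ob′)))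

    height-2-at-unsaturated : HasInArc u 2 → ∀ b → head b ≡ u → f b ≡ 2
    height-2-at-unsaturated has2 b b↦u with f∈12 b
    ... | inj₁ fb≡1 = ⊥-elim (unsat (inj₁ ((b , b↦u , fb≡1) , has2)))
    ... | inj₂ fb≡2 = fb≡2

  inherits-origin : ∀ a → tail a ≢ s → ¬ Saturated (tail a) origin →
                    ∀ b → head b ≡ tail a → f b ≡ 2 → origin a ≡ origin b
  inherits-origin a ta≢s unsat b b↦ fb≡2 =
    trans (origin-unfold a) (picks (tail a ≟ s) (saturated? (tail a) origin) (hasInArc? (tail a) 2))
    where
    picks : ∀ d₀ d d₂ → pick a origin d₀ d d₂ ≡ origin b
    picks (yes ta≡s) _         _                         = ⊥-elim (ta≢s ta≡s)
    picks (no _)     (yes sat) _                         = ⊥-elim (unsat sat)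
    picks (no _)     (no _)    (yes (b₀ , b₀↦ , fb₀≡2)) = same-origin unsat b₀↦ b↦ fb₀≡2 fb≡2
    picks (no _)     (no _)    (no ¬has2)                = ⊥-elim (¬has2 (b , b↦ , fb≡2))

  data OriginCase (a : Arc G) : Set where
    fresh     : origin a ≡ a → OriginCase a
    inherited : tail a ≢ s → (∀ b → head b ≡ tail a → origin a ≡ origin b) → OriginCase a

  originCase : ∀ a → OriginCase a
  originCase a =
    classify (tail a ≟ s) (saturated? (tail a) origin) (hasInArc? (tail a) 2) (origin-unfold a)
    where
    classify : ∀ d₀ d d₂ → origin a ≡ pick a origin d₀ d d₂ → OriginCase a
    classify (yes _)   _          _          = fresh
    classify (no _)    (yes _)    _          = fresh
    classify (no ta≢s) (no unsat) (yes has2) _ = inherited ta≢s λ b b↦ →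
      inherits-origin a ta≢s unsat b b↦ (height-2-at-unsaturated unsat has2 b b↦)
    classify (no _)    (no _)     (no _)     = fresh

  mutual
    origin-on-walk : ∀ {a} → Acc Feeds a → ∀ {u} (w : Walk G s u) → tail a ≡ u →
                     origin a ∈ a ∷ arcsOf G w
    origin-on-walk {a} acc-a w ta≡u = case originCase a of λ where
      (fresh oa≡a)                → here oa≡a
      (inherited ta≢s inherits)   → there (inherited-on-walk acc-a (lastArc w) ta≡u ta≢s inherits)

    inherited-on-walk : ∀ {a u} {w : Walk G s u} → Acc Feeds a → LastArc w → tail a ≡ u →
                        tail a ≢ s → (∀ b → head b ≡ tail a → origin a ≡ origin b) →
                        origin a ∈ arcsOf G w
    inherited-on-walk _             none        ta≡s  ta≢s _        = ⊥-elim (ta≢s ta≡s)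
    inherited-on-walk (acc feeders) (last b w′) ta≡hb _    inherits =
      ∈-snoc⁺ b refl w′ (subst (_∈ b ∷ arcsOf G w′) (sym (inherits b (sym ta≡hb)))
                          (origin-on-walk (feeders (sym ta≡hb)) w′ refl))

  origin-on-path : ∀ {v} (w : Walk G s v) → v ≢ s → ∃ λ a → head a ≡ v × origin a ∈ arcsOf G w
  origin-on-path w v≢s = on-path (lastArc w) v≢s
    where
    on-path : ∀ {v} {w : Walk G s v} → LastArc w → v ≢ s →
              ∃ λ a → head a ≡ v × origin a ∈ arcsOf G w
    on-path none        s≢s = ⊥-elim (s≢s refl)
    on-path (last a w′) _   =
      a , refl , ∈-snoc⁺ a refl w′ (origin-on-walk (feeds-wellFounded a) w′ refl)

  unsaturated⇒¬disjointPaths : ∀ {v} → v ≢ s → ¬ HasInArc v 1 → ¬ Saturated v origin →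
                               ¬ DisjointPaths G s v 2
  unsaturated⇒¬disjointPaths v≢s ¬has1 unsat (P , P#P) =
    let a₀ , a₀↦v , oa₀∈P₀ = origin-on-path (P 0F) v≢s
        a₁ , a₁↦v , oa₁∈P₁ = origin-on-path (P 1F) v≢s
        oa₀≡oa₁ = same-origin unsat a₀↦v a₁↦v (¬HasInArc-1⇒height-2 ¬has1 a₀ a₀↦v)
                                              (¬HasInArc-1⇒height-2 ¬has1 a₁ a₁↦v)
    in P#P 0F 1F (λ ()) (origin a₀) oa₀∈P₀ (subst (_∈ arcsOf G (P 1F)) (sym oa₀≡oa₁) oa₁∈P₁)

module Sufficiency (G : Digraph) (s : Node G) (acyclic : Acyclic G)
                   (f : Arc G → ℕ) (f∈12 : ∀ a → f a ≡ 1 ⊎ f a ≡ 2)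
                   (F : Field) (ι : Arc G → Field.Carrier F)
                   (ι-injective : ∀ {a b} → Field._≈_ F (ι a) (ι b) → a ≡ b) where
  open import Data.List.Membership.Propositional using (_∈_)
  open Digraph G
  open InArcs G
  open InArcHeights G f f∈12
  open Origins G s acyclic f f∈12
  open Field F using (_≈_; 1#) renaming (refl to ≈-refl)
  open CodeAlgebra G F

  code : Arc G → V
  code a with f∈12 a
  ... | inj₁ _ = e₁
  ... | inj₂ _ = ι (origin a) , 1#

  code-1 : ∀ {a} → f a ≡ 1 → code a ≡ e₁
  code-1 {a} fa≡1 with f∈12 a
  ... | inj₁ _     = refl
  ... | inj₂ fa≡2 = ⊥-elim (ℕ.1+n≢n (trans (sym fa≡2) fa≡1))

  code-2 : ∀ {a} → f a ≡ 2 → code a ≡ (ι (origin a) , 1#)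
  code-2 {a} fa≡2 with f∈12 a
  ... | inj₁ fa≡1 = ⊥-elim (ℕ.1+n≢n (trans (sym fa≡2) fa≡1))
  ... | inj₂ _     = refl

  heights : ∀ a → HeightIs G F (code a) (f a)
  heights a with f∈12 a
  ... | inj₁ fa≡1 = subst (HeightIs G F e₁) (sym fa≡1) (h1 ≈-refl 1≉0)
  ... | inj₂ fa≡2 = subst (HeightIs G F (ι (origin a) , 1#)) (sym fa≡2) (h2 1≉0)

  Receives : Node G → V → Set
  Receives = InSpanIn G F code

  receives-height-1 : ∀ {u} → HasInArc u 1 → Receives u e₁
  receives-height-1 (b , b↦u , fb≡1) = subst (Receives _) (code-1 fb≡1) (span-inArc code b↦u)

  receives-height-2 : ∀ {u b} → head b ≡ u → f b ≡ 2 → Receives u (ι (origin b) , 1#)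
  receives-height-2 b↦u fb≡2 = subst (Receives _) (code-2 fb≡2) (span-inArc code b↦u)

  receives-all-when-saturated : ∀ {u} → Saturated u origin → ∀ x → Receives u x
  receives-all-when-saturated {u} (inj₁ (has1 , (b , b↦u , fb≡2))) =
    span-all e₁∈ (span-e₂ _ e₁∈ (receives-height-2 b↦u fb≡2))
    where
    e₁∈ : Receives u e₁
    e₁∈ = receives-height-1 has1
  receives-all-when-saturated {u} (inj₂ (b , b′ , b↦u , b′↦u , fb≡2 , fb′≡2 , ob≢ob′)) =
    span-all e₁∈ (span-e₂ _ e₁∈ (receives-height-2 b↦u fb≡2))
    where
    e₁∈ : Receives u e₁
    e₁∈ = span-e₁ (ob≢ob′ ∘ ι-injective) (receives-height-2 b↦u fb≡2) (receives-height-2 b′↦u fb′≡2)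

  receives-e₁ : ∀ {u} → u ≢ s → (¬ λ≥ G s u 2 → HasInArc u 1) → Receives u e₁
  receives-e₁ {u} u≢s has1-unless-two with hasInArc? u 1 | saturated? u origin
  ... | yes has1 | _         = receives-height-1 has1
  ... | no  _    | yes sat   = receives-all-when-saturated sat e₁
  ... | no  ¬has1 | no unsat =
    ⊥-elim (¬has1 (has1-unless-two (unsaturated⇒¬disjointPaths u≢s ¬has1 unsat)))

  receives-all : ∀ {u} → u ≢ s → λ≥ G s u 2 → HasInArc u 2 → ∀ x → Receives u x
  receives-all {u} u≢s two has2 with hasInArc? u 1 | saturated? u origin
  ... | yes has1  | _        = receives-all-when-saturated (inj₁ (has1 , has2))
  ... | no  _     | yes sat  = receives-all-when-saturated sat
  ... | no  ¬has1 | no unsat = ⊥-elim (unsaturated⇒¬disjointPaths u≢s ¬has1 unsat two)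

  receives-own-code : (∀ a → tail a ≢ s → f a ≡ 2 → HasInArc (tail a) 2) →
                    ∀ a → tail a ≢ s → f a ≡ 2 → Receives (tail a) (ι (origin a) , 1#)
  receives-own-code condition₁ a ta≢s fa≡2 = case saturated? (tail a) origin of λ where
    (yes sat)  → receives-all-when-saturated sat _
    (no unsat) → let b , b↦ , fb≡2 = condition₁ a ta≢s fa≡2
                 in subst (λ o → Receives (tail a) (ι o , 1#))
                          (sym (inherits-origin a ta≢s unsat b b↦ fb≡2)) (receives-height-2 b↦ fb≡2)

  linear : (∀ a → tail a ≢ s → f a ≡ 2 → HasInArc (tail a) 2) →
           (∀ a → tail a ≢ s → f a ≡ 1 → HasInArc (tail a) 1 ⊎ λ≥ G s (tail a) 2) →
           IsLinearNetworkCode G F s code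
  linear condition₁ condition₂ a ta≢s with f∈12 a
  ... | inj₁ fa≡1 = receives-e₁ ta≢s has1-unless-two
    where
    has1-unless-two : ¬ λ≥ G s (tail a) 2 → HasInArc (tail a) 1
    has1-unless-two ¬two with condition₂ a ta≢s fa≡1
    ... | inj₁ has1 = has1
    ... | inj₂ two  = ⊥-elim (¬two two)
  ... | inj₂ fa≡2 = receives-own-code condition₁ a ta≢s fa≡2

  module _ (τ : Demand G s) (proper : Proper G τ) where
    open Demand τ

    performs : (∀ t → t ∈ₛ T₁ → λ≡ G s t 1 → ∃ λ b → b ∈ inArcs G t × f b ≡ 1) →
               (∀ t → t ∈ₛ T₂ → ∃ λ b → b ∈ inArcs G t × f b ≡ 2) →
               ∀ v → v ≢ s → ∀ d → DemandIs G τ v d → PerformanceAtLeast G F code v d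
    performs condition₃ _ v v≢s .1 (in₁ v∈T₁) 1 _ _ = receives-e₁ v≢s λ ¬two →
      let b , b∈ , fb≡1 = condition₃ v v∈T₁ (proj₁ proper v v∈T₁ , ¬two) in b , ∈-inArcs⁻ b∈ , fb≡1
    performs _ _ v v≢s .1 (in₁ _) (suc (suc _)) _ (s≤s ())
    performs _ condition₄ v v≢s .2 (in₂ v∈T₂) j _ _ =
      let b , b∈ , fb≡2 = condition₄ v v∈T₂
      in receives-all v≢s (proj₂ proper v v∈T₂) (b , ∈-inArcs⁻ b∈ , fb≡2) _
    performs _ _ v v≢s .0 (none _ _) (suc _) _ ()

module IntegersModulo (p : ℕ) where
  open import Data.Integer using (ℤ; +_; _+_; _*_; -_; _-_; 0ℤ; 1ℤ; ∣_∣)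
  import Data.Integer.Properties as ℤ
  open import Data.Integer.Divisibility.Signed
    using (_∣_; divides; ∣m∣n⇒∣m+n; ∣m⇒∣-m; ∣m⇒∣m*n; ∣n⇒∣m*n; ∣⇒∣ᵤ)
  open import Data.Integer.Tactic.RingSolver using (solve-∀)
  open import Data.Integer.DivMod using (_%ℕ_; _/ℕ_; n%ℕd<d; a≡a%ℕn+[a/ℕn]*n)
  open import Data.Nat using (NonZero; nonTrivial⇒n>1)
  open import Data.Nat.Divisibility using () renaming (_∣_ to _ℕ∣_; ∣⇒≤ to ℕ∣⇒≤)
  open import Data.Nat.Primality using (Prime; prime⇒nonZero; prime⇒nonTrivial)
  open import Data.Nat.Coprimality using (prime⇒coprime; coprime-Bézout)
  open import Data.Nat.GCD using (module Bézout)
  open import Data.List using (upTo)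
  open import Data.List.Membership.Propositional.Properties using (∈-upTo⁺)
  open import Algebra.Structures using (IsCommutativeRing)
  open import Relation.Binary.PropositionalEquality using (module ≡-Reasoning)

  infix 4 _≈_
  -- A record rather than a synonym, so that x and y can be inferred from a proof of x ≈ y.
  record _≈_ (x y : ℤ) : Set where
    constructor ≈-mod
    field
      divides-difference : + p ∣ x - y

  ≡⇒≈ : ∀ {x y} → x ≡ y → x ≈ y
  ≡⇒≈ {x} refl = ≈-mod (divides 0ℤ (ℤ.+-inverseʳ x))

  ≈-sym : ∀ {x y} → x ≈ y → y ≈ x
  ≈-sym {x} {y} (≈-mod x≈y) = ≈-mod (subst (+ p ∣_) (identity x y) (∣m⇒∣-m x≈y))
    where
    identity : ∀ x y → - (x - y) ≡ y - x
    identity = solve-∀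

  ≈-trans : ∀ {x y z} → x ≈ y → y ≈ z → x ≈ z
  ≈-trans {x} {y} {z} (≈-mod x≈y) (≈-mod y≈z) =
    ≈-mod (subst (+ p ∣_) (identity x y z) (∣m∣n⇒∣m+n x≈y y≈z))
    where
    identity : ∀ x y z → (x - y) + (y - z) ≡ x - z
    identity = solve-∀

  +-cong : ∀ {x x′ y y′} → x ≈ x′ → y ≈ y′ → x + y ≈ x′ + y′
  +-cong {x} {x′} {y} {y′} (≈-mod x≈x′) (≈-mod y≈y′) =
    ≈-mod (subst (+ p ∣_) (identity x x′ y y′) (∣m∣n⇒∣m+n x≈x′ y≈y′))
    where
    identity : ∀ x x′ y y′ → (x - x′) + (y - y′) ≡ (x + y) - (x′ + y′)
    identity = solve-∀

  *-cong : ∀ {x x′ y y′} → x ≈ x′ → y ≈ y′ → x * y ≈ x′ * y′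
  *-cong {x} {x′} {y} {y′} (≈-mod x≈x′) (≈-mod y≈y′) =
    ≈-mod (subst (+ p ∣_) (identity x x′ y y′) (∣m∣n⇒∣m+n (∣m⇒∣m*n y x≈x′) (∣n⇒∣m*n x′ y≈y′)))
    where
    identity : ∀ x x′ y y′ → (x - x′) * y + x′ * (y - y′) ≡ x * y - x′ * y′
    identity = solve-∀

  -‿cong : ∀ {x x′} → x ≈ x′ → - x ≈ - x′
  -‿cong {x} {x′} (≈-mod x≈x′) = ≈-mod (subst (+ p ∣_) (identity x x′) (∣m⇒∣-m x≈x′))
    where
    identity : ∀ x x′ → - (x - x′) ≡ - x - - x′
    identity = solve-∀

  isCommutativeRing : IsCommutativeRing _≈_ _+_ _*_ -_ 0ℤ 1ℤ
  isCommutativeRing = record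
    { isRing = record
      { +-isAbelianGroup = record
        { isGroup = record
          { isMonoid = record
            { isSemigroup = record
              { isMagma = record
                { isEquivalence = record { refl = ≡⇒≈ refl ; sym = ≈-sym ; trans = ≈-trans }
                ; ∙-cong        = +-cong
                }
              ; assoc = λ x y z → ≡⇒≈ (ℤ.+-assoc x y z)
              }
            ; identity = (λ x → ≡⇒≈ (ℤ.+-identityˡ x)) , (λ x → ≡⇒≈ (ℤ.+-identityʳ x))
            }
          ; inverse = (λ x → ≡⇒≈ (ℤ.+-inverseˡ x)) , (λ x → ≡⇒≈ (ℤ.+-inverseʳ x))
          ; ⁻¹-cong = -‿cong
          }
        ; comm = λ x y → ≡⇒≈ (ℤ.+-comm x y)
        }
      ; *-cong     = *-cong
      ; *-assoc    = λ x y z → ≡⇒≈ (ℤ.*-assoc x y z)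
      ; *-identity = (λ x → ≡⇒≈ (ℤ.*-identityˡ x)) , (λ x → ≡⇒≈ (ℤ.*-identityʳ x))
      ; distrib    = (λ x y z → ≡⇒≈ (ℤ.*-distribˡ-+ x y z)) , (λ x y z → ≡⇒≈ (ℤ.*-distribʳ-+ x y z))
      }
    ; *-comm = λ x y → ≡⇒≈ (ℤ.*-comm x y)
    }

  module _ (p-prime : Prime p) where
    private instance
      p≢0 : NonZero p
      p≢0 = prime⇒nonZero p-prime

    ≈-residue : ∀ x → x ≈ + (x %ℕ p)
    ≈-residue x = ≈-mod (divides (x /ℕ p)
      (trans (cong (_- + (x %ℕ p)) (a≡a%ℕn+[a/ℕn]*n x p)) (cancel (+ (x %ℕ p)) (x /ℕ p * + p))))
      where
      cancel : ∀ a b → (a + b) - a ≡ b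
      cancel = solve-∀

    residue-injective : ∀ {i j} → i < p → j < p → + i ≈ + j → i ≡ j
    residue-injective {i} {j} i<p j<p (≈-mod p∣i-j) =
      ℕ.∣m-n∣≡0⇒m≡n (small-multiple (subst (p ℕ∣_) (∣+i-+j∣ i j) (∣⇒∣ᵤ p∣i-j))
                                     (ℕ.≤-<-trans (ℕ.∣m-n∣≤m⊔n i j) (ℕ.⊔-lub i<p j<p)))
      where
      small-multiple : ∀ {d} → p ℕ∣ d → d < p → d ≡ 0
      small-multiple {zero}  _   _   = refl
      small-multiple {suc _} p∣d d<p = ⊥-elim (ℕ.<⇒≱ d<p (ℕ∣⇒≤ p∣d))
      ∣+i-+j∣ : ∀ i j → ∣ + i - + j ∣ ≡ Nat.∣ i - j ∣
      ∣+i-+j∣ i j with ℕ.≤-total i j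
      ... | inj₁ i≤j = trans (cong ∣_∣ (ℤ.m-n≡m⊖n i j))
                         (trans (ℤ.∣⊖∣-≤ i≤j) (sym (ℕ.m≤n⇒∣m-n∣≡n∸m i≤j)))
      ... | inj₂ j≤i = trans (cong ∣_∣ (ℤ.m-n≡m⊖n i j)) (trans (ℤ.∣m⊖n∣≡∣n⊖m∣ i j)
                         (trans (ℤ.∣⊖∣-≤ j≤i) (sym (trans (ℕ.∣-∣-comm i j) (ℕ.m≤n⇒∣m-n∣≡n∸m j≤i)))))

    0≉1 : ¬ 0ℤ ≈ 1ℤ
    0≉1 0≈1 = ℕ.0≢1+n (residue-injective (ℕ.<-trans (s≤s z≤n) 1<p) 1<p 0≈1)
      where
      1<p : 1 < p
      1<p = nonTrivial⇒n>1 p {{prime⇒nonTrivial p-prime}}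

    residue-inverse : ∀ r → .{{NonZero r}} → r < p → ∃ λ y → + r * y ≈ 1ℤ
    residue-inverse r r<p with coprime-Bézout (prime⇒coprime p-prime r<p)
    ... | Bézout.+- u v 1+vr≡up = - + v , ≈-mod (divides (- + u) (begin
      + r * - + v - 1ℤ          ≡⟨ identity (+ r) (+ v) ⟩
      - (1ℤ + + v * + r)        ≡⟨ cong (λ n → - (1ℤ + n)) (ℤ.pos-* v r) ⟨
      - (+ (1 Nat.+ v Nat.* r)) ≡⟨ cong (λ n → - + n) 1+vr≡up ⟩
      - + (u Nat.* p)           ≡⟨ cong -_ (ℤ.pos-* u p) ⟩
      - (+ u * + p)             ≡⟨ ℤ.neg-distribˡ-* (+ u) (+ p) ⟩
      - + u * + p               ∎))
      where
      open ≡-Reasoning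
      identity : ∀ a b → a * - b - 1ℤ ≡ - (1ℤ + b * a)
      identity = solve-∀
    ... | Bézout.-+ u v 1+up≡vr = + v , ≈-mod (divides (+ u) (begin
      + r * + v - 1ℤ             ≡⟨ cong (_- 1ℤ) (ℤ.*-comm (+ r) (+ v)) ⟩
      + v * + r - 1ℤ             ≡⟨ cong (_- 1ℤ) (ℤ.pos-* v r) ⟨
      + (v Nat.* r) - 1ℤ         ≡⟨ cong (λ n → + n - 1ℤ) 1+up≡vr ⟨
      + (1 Nat.+ u Nat.* p) - 1ℤ ≡⟨ cong (λ n → 1ℤ + n - 1ℤ) (ℤ.pos-* u p) ⟩
      1ℤ + + u * + p - 1ℤ        ≡⟨ identity (+ u * + p) ⟩
      + u * + p                  ∎))
      where
      open ≡-Reasoning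
      identity : ∀ a → 1ℤ + a - 1ℤ ≡ a
      identity = solve-∀

    inverse : ∀ x → ¬ x ≈ 0ℤ → ∃ λ y → x * y ≈ 1ℤ
    inverse x x≉0 with x %ℕ p in r≡ | n%ℕd<d x p
    ... | zero  | _   = ⊥-elim (x≉0 (≈-trans (≈-residue x) (≡⇒≈ (cong +_ r≡))))
    ... | suc r | r<p with residue-inverse (suc r) r<p
    ...   | y , ry≈1 = y , ≈-trans (*-cong x≈r (≡⇒≈ refl)) ry≈1
      where
      x≈r : x ≈ + suc r
      x≈r = ≈-trans (≈-residue x) (≡⇒≈ (cong +_ r≡))

    ℤ/pℤ : Field
    ℤ/pℤ = record
      { commutativeRing = record { isCommutativeRing = isCommutativeRing }
      ; 0≉1             = 0≉1
      ; inverse         = inverse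
      }

    toℕ-injective-mod : ∀ {m} → m ≤ p → ∀ {i j : Fin m} → + toℕ i ≈ + toℕ j → i ≡ j
    toℕ-injective-mod m≤p {i} {j} i≈j =
      FinP.toℕ-injective
        (residue-injective (ℕ.<-≤-trans (FinP.toℕ<n i) m≤p) (ℕ.<-≤-trans (FinP.toℕ<n j) m≤p) i≈j)

    ℤ/pℤ-finite : IsFinite ℤ/pℤ
    ℤ/pℤ-finite = map +_ (upTo p) , λ x →
      Any.map (λ r≡ → ≈-trans (≈-residue x) (≡⇒≈ r≡)) (∈-map⁺ +_ (∈-upTo⁺ (n%ℕd<d x p)))

module PrimesAbove where
  open import Data.Nat using (NonZero; _!)
  open import Data.Nat.Divisibility using (_∣_; ∣-trans; ∣1⇒≡1; ∣m+n∣m⇒∣n; m∣m*n; m≤n⇒m!∣n!)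
  open import Data.Nat.ListAction using (product)
  open import Data.Nat.Primality using (Prime; ¬prime[1])
  open import Data.Nat.Primality.Factorisation using (factorise; PrimeFactorisation)

  prime-divisor : ∀ n → .{{NonZero n}} → n ≢ 1 → ∃ λ p → Prime p × p ∣ n
  prime-divisor n n≢1 = divisor-of (factors fn) (isFactorisation fn) (factorsPrime fn)
    where
    open PrimeFactorisation
    fn : PrimeFactorisation n
    fn = factorise n
    divisor-of : ∀ ps → n ≡ product ps → All Prime ps → ∃ λ p → Prime p × p ∣ n
    divisor-of []       n≡1 _             = ⊥-elim (n≢1 n≡1)
    divisor-of (p ∷ ps) n≡  (p-prime ∷ _) = p , p-prime , subst (p ∣_) (sym n≡) (m∣m*n (product ps))

  prime-above : ∀ m → ∃ λ p → Prime p × m < p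
  prime-above m with prime-divisor (suc (m !)) 1+m!≢1
    where
    1+m!≢1 : suc (m !) ≢ 1
    1+m!≢1 1+m!≡1 = ℕ.<⇒≢ (ℕ.1≤n! m) (sym (ℕ.suc-injective 1+m!≡1))
  ... | p , p-prime , p∣1+m! = p , p-prime , ℕ.≰⇒> p≰m
    where
    q∣q! : ∀ {q} → Prime q → q ∣ q !
    q∣q! {suc q} _ = m∣m*n (q !)
    p≰m : ¬ p ≤ m
    p≰m p≤m = ¬prime[1] (subst Prime (∣1⇒≡1 p∣1) p-prime)
      where
      p∣1 : p ∣ 1
      p∣1 = ∣m+n∣m⇒∣n (subst (p ∣_) (ℕ.+-comm 1 (m !)) p∣1+m!)
                       (∣-trans (q∣q! p-prime) (m≤n⇒m!∣n! p≤m))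

open import Data.Fin.Subset using (_∈_)
open import Data.Integer using (+_)
open import Function.Bundles using (_⇔_; mk⇔)
import Data.List.Membership.Propositional as L

HeightConditions : (G : Digraph) (s : Node G) → Demand G s → (Arc G → ℕ) → Set
HeightConditions G s τ f =
      (∀ a → Digraph.tail G a ≢ s → f a ≡ 2 →
         ∃ λ b → Digraph.head G b ≡ Digraph.tail G a × f b ≡ 2)
    × (∀ a → Digraph.tail G a ≢ s → f a ≡ 1 →
         (∃ λ b → Digraph.head G b ≡ Digraph.tail G a × f b ≡ 1)
         ⊎ λ≥ G s (Digraph.tail G a) 2)
    × (∀ t → t ∈ Demand.T₁ τ → λ≡ G s t 1 →
         ∃ λ b → b L.∈ inArcs G t × f b ≡ 1)
    × (∀ t → t ∈ Demand.T₂ τ →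
         ∃ λ b → b L.∈ inArcs G t × f b ≡ 2)

feasible⇒conditions : ∀ (G : Digraph) s → Acyclic G → SingleSource G s → (τ : Demand G s) →
                      (f : Arc G → ℕ) → (∀ a → f a ≡ 1 ⊎ f a ≡ 2) →
                      FeasibleHeightFunction G τ f → HeightConditions G s τ f
feasible⇒conditions G s acyclic single-source τ f f∈12 (F , _ , c , linear , heights , performs) =
  condition₁ , condition₂ , condition₃ τ performs , condition₄ τ performs
  where open Necessity G s acyclic single-source f f∈12 F c linear heights

conditions⇒feasible : ∀ (G : Digraph) s → Acyclic G → (τ : Demand G s) → Proper G τ →
                      (f : Arc G → ℕ) → (∀ a → f a ≡ 1 ⊎ f a ≡ 2) →
                      HeightConditions G s τ f → FeasibleHeightFunction G τ f
conditions⇒feasible G s acyclic τ proper f f∈12 (condition₁ , condition₂ , condition₃ , condition₄)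
  with PrimesAbove.prime-above (Digraph.m G)
... | p , p-prime , m<p =
  ℤ/pℤ p p-prime , ℤ/pℤ-finite p p-prime , code ,
  linear condition₁ condition₂ , heights , performs τ proper condition₃ condition₄
  where
  open IntegersModulo using (ℤ/pℤ; ℤ/pℤ-finite; toℕ-injective-mod)
  open Sufficiency G s acyclic f f∈12 (ℤ/pℤ p p-prime) (+_ ∘ toℕ)
                   (toℕ-injective-mod p p-prime (ℕ.<⇒≤ m<p))

mainTheorem8 :
    (G : Digraph) (s : Node G) →
    Acyclic G → SingleSource G s → AllReachableFrom G s →
    (τ : Demand G s) → Proper G τ →
    (f : Arc G → ℕ) → (∀ a → f a ≡ 1 ⊎ f a ≡ 2) →
    FeasibleHeightFunction G τ f ⇔
      ( (∀ a → Digraph.tail G a ≢ s → f a ≡ 2 →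
           ∃ λ b → Digraph.head G b ≡ Digraph.tail G a × f b ≡ 2)
      × (∀ a → Digraph.tail G a ≢ s → f a ≡ 1 →
           (∃ λ b → Digraph.head G b ≡ Digraph.tail G a × f b ≡ 1)
           ⊎ λ≥ G s (Digraph.tail G a) 2)
      × (∀ t → t ∈ Demand.T₁ τ → λ≡ G s t 1 →
           ∃ λ b → b L.∈ inArcs G t × f b ≡ 1)
      × (∀ t → t ∈ Demand.T₂ τ →
           ∃ λ b → b L.∈ inArcs G t × f b ≡ 2) )
mainTheorem8 G s acyclic single-source _ τ proper f f∈12 =
  mk⇔ (feasible⇒conditions G s acyclic single-source τ f f∈12)
      (conditions⇒feasible G s acyclic τ proper f f∈12)
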